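{- Let $G$ be a $2d$-regular graph on the vertex set $[n]$. Then $\tau(G,n)=\tau_{\text{lab}}(G,n)=dn$.
   Context: Semi-random no-replacement multigraph process on $[n]=\{1,\dots,n\}$: let $\pi_1,\pi_2,\dots$ be independent uniformly random permutations in $S_n$. Builder's multigraph starts empty on $[n]$. In round $k\ge1$ Builder is offered the vertex $v_k:=\pi_{\lceil k/n\rceil}(k-\lfloor (k-1)/n\rfloor n)$; Builder then chooses a vertex $u_k$ according to his strategy (a rule depending on the history so far) and adds the edge $u_kv_k$ (multiple edges allowed). For a labeled graph $G$ on $[n]$ and a strategy $\mathcal S$, let $\tau(\mathcal S)$ be the least $m$ such that Builder's multigraph after $m$ rounds contains $G$ (resp. some graph isomorphic to $G$) as a subgraph; $\tau_{\text{lab}}(G,n)$ (resp. $\tau(G,n)$) is a random variable with $\Pr(\cdot\le k)=\max_{\mathcal S}\Pr(\tau(\mathcal S)\le k)$ for all $k\ge0$. -}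

module Defs where

open import Data.Nat using (ℕ; suc; _<_; _≤_; _*_; NonZero)
open import Data.Nat.DivMod using (_/_; _%_; m%n<n)
open import Data.Fin using (Fin; fromℕ<)
open import Data.Fin.Permutation using (Permutation′; _⟨$⟩ʳ_)
open import Data.Bool using (Bool; true; false)
open import Data.List using (List; map; upTo; length; filterᵇ; allFin)
open import Data.Product using (Σ; ∃; _×_; _,_)
open import Data.Sum using (_⊎_)
open import Data.Empty using (⊥)
open import Relation.Binary.PropositionalEquality using (_≡_)

record SimpleGraph (n : ℕ) : Set where
  field
    adj    : Fin n → Fin n → Bool
    sym    : ∀ x y → adj x y ≡ adj y x
    irrefl : ∀ x → adj x x ≡ false
open SimpleGraph public

degree : ∀ {n} → SimpleGraph n → Fin n → ℕ
degree {n} G x = length (filterᵇ (adj G x) (allFin n))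

Regular : ∀ {n} → ℕ → SimpleGraph n → Set
Regular r G = ∀ x → degree G x ≡ r

-- An outcome of the randomness: the sequence π_1, π_2, … (0-indexed here).
PermSeq : ℕ → Set
PermSeq n = ℕ → Permutation′ n

-- Offered vertex in round i+1 (i = 0,1,2,… is the 0-indexed round):
-- v_{i+1} = π_{⌊i/n⌋+1}( (i mod n) + 1 ), i.e. the paper's
-- π_{⌈k/n⌉}(k - ⌊(k-1)/n⌋ n) with k = i+1, shifted to 0-indexing.
offered : ∀ {n} .{{_ : NonZero n}} → PermSeq n → ℕ → Fin n
offered {n} π i = π (i / n) ⟨$⟩ʳ fromℕ< (m%n<n i n)

-- History visible to Builder in round i+1: offered vertices v_1,…,v_{i+1}
-- (Builder's own earlier choices are determined by these and his strategy).
history : ∀ {n} .{{_ : NonZero n}} → PermSeq n → ℕ → List (Fin n)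
history π i = map (offered π) (upTo (suc i))

Strategy : ℕ → Set
Strategy n = List (Fin n) → Fin n

chosen : ∀ {n} .{{_ : NonZero n}} → Strategy n → PermSeq n → ℕ → Fin n
chosen S π i = S (history π i)

HasEdge : ∀ {n} .{{_ : NonZero n}} → Strategy n → PermSeq n → ℕ → Fin n → Fin n → Set
HasEdge S π m x y =
  Σ ℕ λ i → i < m ×
    ((chosen S π i ≡ x × offered π i ≡ y) ⊎ (chosen S π i ≡ y × offered π i ≡ x))

ContainsLab : ∀ {n} .{{_ : NonZero n}} → SimpleGraph n → Strategy n → PermSeq n → ℕ → Set
ContainsLab G S π m = ∀ x y → adj G x y ≡ true → HasEdge S π m x y

ContainsCopy : ∀ {n} .{{_ : NonZero n}} → SimpleGraph n → Strategy n → PermSeq n → ℕ → Set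
ContainsCopy G S π m =
  Σ (Permutation′ _) λ σ → ∀ x y → adj G x y ≡ true → HasEdge S π m (σ ⟨$⟩ʳ x) (σ ⟨$⟩ʳ y)

-- "τ = t almost surely" for the optimally played process:
--   for k ≥ t, max_S Pr(τ(S) ≤ k) = 1 : some strategy succeeds by round k on every outcome;
--   for k < t, max_S Pr(τ(S) ≤ k) = 0 : no strategy succeeds by round k on any outcome.
-- (The probability space is uniform over permutation sequences and the events depend
--  only on finitely many permutations, so probability 1 / 0 means all / no outcomes.)
TauIs : ∀ {n} .{{_ : NonZero n}} →
        (Strategy n → PermSeq n → ℕ → Set) → ℕ → Set
TauIs {n} Contains t =
  ∀ k → (t ≤ k → Σ (Strategy n) λ S → ∀ (π : PermSeq n) → Contains S π k)
      × (k < t → ∀ (S : Strategy n) (π : PermSeq n) → Contains S π k → ⊥)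

-- A 2d-regular graph on n vertices has dn edges, and Builder adds one edge per round; double
-- counting degrees shows that no strategy contains G, even up to isomorphism, before round dn.
-- Conversely, all degrees of G are even, so G has an Eulerian orientation, in which every vertex
-- has out-degree d. In the j-th block of n rounds every vertex is offered exactly once, and Builder
-- joins it to its j-th out-neighbour; after d blocks, i.e. dn rounds, all of G has been built.

{-# OPTIONS --safe #-}
module Submission where

open import Defs hiding (sym)
open import Data.Nat using (ℕ; _*_; NonZero)
open import Data.Product using (_×_)

open import Data.Nat.Properties
  using (+-*-semiring; +-commutativeSemigroup; module ≤-Reasoning; suc-injective; ≤-reflexive;
         ≤-trans; <-≤-trans; <⇒≱; m≤m+n; m≤n+m; m<n⇒n≢0; +-comm; +-identityʳ; +-cancelˡ-≡;
         +-mono-≤; +-monoˡ-<; *-comm; *-assoc; *-identityˡ; *-identityʳ; *-zeroʳ; *-suc;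
         *-distribˡ-+; *-monoˡ-≤; *-cancelˡ-≡; *-cancelˡ-≤)
open import Algebra.Properties.CommutativeSemigroup +-commutativeSemigroup
  using (interchange; x∙yz≈y∙xz)
open import Algebra.Properties.Semiring.Sum +-*-semiring
  using (sum-syntax; sum-cong-≗; sum-replicate-zero; ∑-distrib-+; ∑-comm; ∑-permute;
         *-distribˡ-sum; *-distribʳ-sum)
open import Data.Bool.Base using (Bool; true; false; _∧_; T)
open import Data.Fin.Base using (Fin; zero; suc; toℕ; fromℕ<)
open import Data.Fin.Properties using (_≟_; _<?_; <-cmp; toℕ<n; toℕ-injective; toℕ-fromℕ<)
open import Data.Fin.Permutation using (_⟨$⟩ʳ_; _⟨$⟩ˡ_; inverseʳ)
import Data.Fin.Permutation as Permutation
open import Data.List.Base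
  using (List; []; _∷_; _++_; [_]; map; filter; filterᵇ; concatMap; tabulate; allFin; upTo;
         length; reverse)
open import Data.List.Membership.Propositional using (_∈_)
open import Data.List.Membership.Propositional.Properties
  using (∈-∃++; ∈-map⁺; ∈-filter⁺; ∈-allFin; ∈-upTo⁺; ∈-concatMap⁺)
open import Data.List.Properties
  using (map-++; map-∘; map-cong; length-map; length-upTo; upTo-∷ʳ; reverse-++; length-reverse)
open import Data.List.Relation.Unary.Any using (here; there; index)
import Data.List.Relation.Unary.Any as Any
open import Data.List.Relation.Binary.Permutation.Propositional using (_↭_; prep; ↭-sym)
open import Data.List.Relation.Binary.Permutation.Propositional.Properties
  using (shift; map⁺; ↭-length)
open import Data.Nat.Base using (zero; suc; _+_; _≤_; _<_; z≤n; s≤s; _/_; _%_; >-nonZero⁻¹)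
open import Data.Nat.DivMod
  using ([m+kn]%n≡m%n; m<n⇒m%n≡m; m<n⇒m/n≡0; m*n/n≡m; +-distrib-/-∣ʳ)
open import Data.Nat.Divisibility using (_∣_; divides; divides-refl; ∣m+n∣m⇒∣n; ∣1⇒≡1; m∣m*n)
open import Data.Nat.ListAction using (sum)
open import Data.Nat.ListAction.Properties using (sum-++; sum-↭)
open import Data.Nat.Tactic.RingSolver using (solve-∀)
open import Data.Product.Base using (Σ; ∃-syntax; _,_; proj₁; proj₂)
open import Data.Sum.Base using (_⊎_; inj₁; inj₂) renaming (map to ⊎-map)
open import Function.Base using (_∘_; id)
open import Relation.Binary.Definitions using (tri<; tri≈; tri>)
open import Relation.Binary.PropositionalEquality hiding ([_])
open import Relation.Nullary.Decidable using (yes; no; does; dec-true; dec-false; T?)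
open import Relation.Nullary.Negation using (contradiction)
open import Relation.Unary using (Decidable)

private variable
  A B : Set
  n : ℕ

⟦_⟧ : Bool → ℕ
⟦ true ⟧  = 1
⟦ false ⟧ = 0

δ : Fin n → Fin n → ℕ
δ a b = ⟦ does (a ≟ b) ⟧

δ-refl : (a : Fin n) → δ a a ≡ 1
δ-refl a = cong ⟦_⟧ (dec-true (a ≟ a) refl)

δ-≢ : {a b : Fin n} → a ≢ b → δ a b ≡ 0
δ-≢ {a = a} {b} a≢b = cong ⟦_⟧ (dec-false (a ≟ b) a≢b)

δ≢0⇒≡ : {a b : Fin n} → δ a b ≢ 0 → a ≡ b
δ≢0⇒≡ {a = a} {b} δ≢0 with a ≟ b
... | yes a≡b = a≡b
... | no _    = contradiction refl δ≢0

δ*δ≢0⇒≡ : {a b c e : Fin n} → δ a b * δ c e ≢ 0 → a ≡ b × c ≡ e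
δ*δ≢0⇒≡ {a = a} {b} {c} {e} ≢0 with a ≟ b | c ≟ e
... | yes a≡b | yes c≡e = a≡b , c≡e
... | yes _   | no _    = contradiction refl ≢0
... | no _    | _       = contradiction refl ≢0

m+n≢0⇒m≢0⊎n≢0 : ∀ m {k} → m + k ≢ 0 → m ≢ 0 ⊎ k ≢ 0
m+n≢0⇒m≢0⊎n≢0 zero    k≢0 = inj₂ k≢0
m+n≢0⇒m≢0⊎n≢0 (suc m) _   = inj₁ λ ()

2∣m+m : ∀ m → 2 ∣ m + m
2∣m+m m = divides m (trans (cong (m +_) (sym (+-identityʳ m))) (*-comm 2 m))

∑-mono-≤ : {f g : Fin n → ℕ} → (∀ i → f i ≤ g i) → ∑[ i < n ] f i ≤ ∑[ i < n ] g i
∑-mono-≤ {n = zero}  f≤g = z≤n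
∑-mono-≤ {n = suc n} f≤g = +-mono-≤ (f≤g zero) (∑-mono-≤ (f≤g ∘ suc))

∑-const : ∀ n c → ∑[ i < n ] c ≡ n * c
∑-const zero    c = refl
∑-const (suc n) c = cong (c +_) (∑-const n c)

∑-δ : (a : Fin n) → ∑[ b < n ] δ a b ≡ 1
∑-δ {n = suc n} zero    = cong suc (sum-replicate-zero n)
∑-δ {n = suc n} (suc a) = ∑-δ a

∑-δ-sift : (v : Fin n) (F : Fin n → ℕ) → ∑[ x < n ] (δ x v * F x) ≡ F v
∑-δ-sift {n = suc n} zero    F =
  trans (cong₂ _+_ (+-identityʳ (F zero)) (sum-replicate-zero n)) (+-identityʳ (F zero))
∑-δ-sift {n = suc n} (suc v) F = ∑-δ-sift v (F ∘ suc)

∑∑-sift : (F : Fin n → Fin n → ℕ) (v : Fin n) →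
          ∑[ x < n ] ∑[ y < n ] (F x y * δ x v) ≡ ∑[ y < n ] F v y
∑∑-sift {n = n} F v = trans (sum-cong-≗ pull) (∑-δ-sift v (λ x → ∑[ y < n ] F x y))
  where
  pull : ∀ x → ∑[ y < n ] (F x y * δ x v) ≡ δ x v * ∑[ y < n ] F x y
  pull x = sym (trans (*-distribˡ-sum (δ x v) (F x)) (sum-cong-≗ λ y → *-comm (δ x v) (F x y)))

weight : (A → ℕ) → List A → ℕ
weight W xs = sum (map W xs)

weight-++ : (W : A → ℕ) (xs ys : List A) → weight W (xs ++ ys) ≡ weight W xs + weight W ys
weight-++ W xs ys = trans (cong sum (map-++ W xs ys)) (sum-++ (map W xs) (map W ys))

weight-↭ : (W : A → ℕ) {xs ys : List A} → xs ↭ ys → weight W xs ≡ weight W ys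
weight-↭ W xs↭ys = sum-↭ (map⁺ W xs↭ys)

weight-cong : {V W : A → ℕ} → (∀ x → V x ≡ W x) → (xs : List A) → weight V xs ≡ weight W xs
weight-cong V≗W xs = cong sum (map-cong V≗W xs)

weight-+ : (V W : A → ℕ) (xs : List A) →
           weight (λ x → V x + W x) xs ≡ weight V xs + weight W xs
weight-+ V W []       = refl
weight-+ V W (x ∷ xs) =
  trans (cong (V x + W x +_) (weight-+ V W xs)) (interchange (V x) (W x) _ _)

weight-const : (c : ℕ) (xs : List A) → weight (λ _ → c) xs ≡ c * length xs
weight-const c []       = sym (*-zeroʳ c)
weight-const c (x ∷ xs) = trans (cong (c +_) (weight-const c xs)) (sym (*-suc c (length xs)))

weight-∈ : (W : A → ℕ) {x : A} {xs : List A} → x ∈ xs → W x ≤ weight W xs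
weight-∈ W (here refl)               = m≤m+n _ _
weight-∈ W {xs = y ∷ _} (there x∈xs) = ≤-trans (weight-∈ W x∈xs) (m≤n+m _ (W y))

weight≢0⇒∃ : (W : A → ℕ) (xs : List A) → weight W xs ≢ 0 → ∃[ x ] x ∈ xs × W x ≢ 0
weight≢0⇒∃ W []       ≢0 = contradiction refl ≢0
weight≢0⇒∃ W (x ∷ xs) ≢0 with m+n≢0⇒m≢0⊎n≢0 (W x) ≢0
... | inj₁ Wx≢0   = x , here refl , Wx≢0
... | inj₂ rest≢0 with y , y∈xs , Wy≢0 ← weight≢0⇒∃ W xs rest≢0 =
  y , there y∈xs , Wy≢0

∑-weight : {m : ℕ} (W : Fin m → A → ℕ) (xs : List A) →
           ∑[ i < m ] weight (W i) xs ≡ weight (λ x → ∑[ i < m ] W i x) xs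
∑-weight {m = m} W []       = sum-replicate-zero m
∑-weight         W (x ∷ xs) =
  trans (∑-distrib-+ (λ i → W i x) (λ i → weight (W i) xs)) (cong (_ +_) (∑-weight W xs))

weight-tabulate : (W : A → ℕ) (f : Fin n → A) → weight W (tabulate f) ≡ ∑[ i < n ] W (f i)
weight-tabulate {n = zero}  W f = refl
weight-tabulate {n = suc n} W f = cong (W (f zero) +_) (weight-tabulate W (f ∘ suc))

weight-concatMap : (W : A → ℕ) (f : B → List A) (xs : List B) →
                   weight W (concatMap f xs) ≡ weight (weight W ∘ f) xs
weight-concatMap W f []       = refl
weight-concatMap W f (x ∷ xs) = trans (weight-++ W (f x) (concatMap f xs))
                                      (cong (weight W (f x) +_) (weight-concatMap W f xs))

weight-map : (W : A → ℕ) (f : B → A) (xs : List B) → weight W (map f xs) ≡ weight (W ∘ f) xs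
weight-map W f xs = cong sum (sym (map-∘ xs))

weight-filterᵇ : (W : A → ℕ) (p : A → Bool) (xs : List A) →
                 weight W (filterᵇ p xs) ≡ weight (λ x → ⟦ p x ⟧ * W x) xs
weight-filterᵇ W p []       = refl
weight-filterᵇ W p (x ∷ xs) with p x
... | true  = cong₂ _+_ (sym (+-identityʳ (W x))) (weight-filterᵇ W p xs)
... | false = weight-filterᵇ W p xs

length-filter≡weight : {P : A → Set} (P? : Decidable P) (xs : List A) →
                       length (filter P? xs) ≡ weight (λ x → ⟦ does (P? x) ⟧) xs
length-filter≡weight P? []       = refl
length-filter≡weight P? (x ∷ xs) with does (P? x)
... | true  = cong suc (length-filter≡weight P? xs)
... | false = length-filter≡weight P? xs

-- Multigraphs as edge lists

Edge : ℕ → Set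
Edge n = Fin n × Fin n

Multigraph : ℕ → Set
Multigraph n = List (Edge n)

infix 4 _~_ _≈_

_~_ : Edge n → Edge n → Set
(p , q) ~ (a , b) = (p ≡ a × q ≡ b) ⊎ (p ≡ b × q ≡ a)

~-refl : (e : Edge n) → e ~ e
~-refl _ = inj₁ (refl , refl)

~-swap : {p q : Fin n} {f : Edge n} → (p , q) ~ f → (q , p) ~ f
~-swap (inj₁ (refl , refl)) = inj₂ (refl , refl)
~-swap (inj₂ (refl , refl)) = inj₁ (refl , refl)

Symmetric : (Edge n → ℕ) → Set
Symmetric W = ∀ a b → W (a , b) ≡ W (b , a)

symmetric-resp-~ : {W : Edge n → ℕ} → Symmetric W → {e f : Edge n} → e ~ f → W e ≡ W f
symmetric-resp-~ W-sym (inj₁ (refl , refl)) = refl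
symmetric-resp-~ W-sym (inj₂ (refl , refl)) = W-sym _ _

-- Equality of the underlying undirected multigraphs, i.e. up to reordering the list and
-- reversing edges: these are exactly the changes that no symmetric weight can detect.
record _≈_ (E F : Multigraph n) : Set where
  constructor sameWeights
  field
    same-weight : ∀ W → Symmetric W → weight W E ≡ weight W F
open _≈_

private variable
  E F H O : Multigraph n

≈-refl : E ≈ E
≈-refl = sameWeights λ _ _ → refl

≈-sym : E ≈ F → F ≈ E
≈-sym E≈F = sameWeights λ W W-sym → sym (same-weight E≈F W W-sym)

≈-trans : E ≈ F → F ≈ H → E ≈ H
≈-trans E≈F F≈H = sameWeights λ W W-sym →
  trans (same-weight E≈F W W-sym) (same-weight F≈H W W-sym)

↭⇒≈ : E ↭ F → E ≈ F
↭⇒≈ E↭F = sameWeights λ W _ → weight-↭ W E↭F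

∷-cong : {e f : Edge n} → e ~ f → E ≈ F → e ∷ E ≈ f ∷ F
∷-cong e~f E≈F = sameWeights λ W W-sym →
  cong₂ _+_ (symmetric-resp-~ W-sym e~f) (same-weight E≈F W W-sym)

∷-cancel : {e f : Edge n} → e ~ f → e ∷ E ≈ f ∷ F → E ≈ F
∷-cancel {F = F} {e = e} e~f eE≈fF = sameWeights λ W W-sym → +-cancelˡ-≡ (W e) _ _
  (trans (same-weight eE≈fF W W-sym) (cong (_+ weight W F) (sym (symmetric-resp-~ W-sym e~f))))

subdivide-≈ : {p q y z : Fin n} (x : Fin n) → (p , q) ~ (y , z) → E ≈ F →
              (p , x) ∷ (x , q) ∷ E ≈ (x , y) ∷ (x , z) ∷ F
subdivide-≈ {y = y} {z} x (inj₁ (refl , refl)) E≈F = sameWeights λ W W-sym →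
  cong₂ _+_ (W-sym y x) (cong (W (x , z) +_) (same-weight E≈F W W-sym))
subdivide-≈ {E = E} {y = y} {z} x (inj₂ (refl , refl)) E≈F = sameWeights λ W W-sym →
  trans (x∙yz≈y∙xz (W (z , x)) (W (x , y)) (weight W E))
        (cong (W (x , y) +_) (cong₂ _+_ (W-sym z x) (same-weight E≈F W W-sym)))

incidence : Fin n → Edge n → ℕ
incidence v (a , b) = δ a v + δ b v

deg outdeg indeg : Multigraph n → Fin n → ℕ
deg    E v = weight (incidence v) E
outdeg E v = weight (λ e → δ (proj₁ e) v) E
indeg  E v = weight (λ e → δ (proj₂ e) v) E

incidence-symmetric : (v : Fin n) → Symmetric (incidence v)
incidence-symmetric v a b = +-comm (δ a v) (δ b v)

deg≡outdeg+indeg : (E : Multigraph n) (v : Fin n) → deg E v ≡ outdeg E v + indeg E v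
deg≡outdeg+indeg E v = weight-+ (λ e → δ (proj₁ e) v) (λ e → δ (proj₂ e) v) E

incidence≢0⇒~ : {x : Fin n} (e : Edge n) → incidence x e ≢ 0 → ∃[ z ] e ~ (x , z)
incidence≢0⇒~ (p , q) ≢0 with m+n≢0⇒m≢0⊎n≢0 (δ p _) ≢0
... | inj₁ δpx≢0 = q , inj₁ (δ≢0⇒≡ δpx≢0 , refl)
... | inj₂ δqx≢0 = p , inj₂ (refl , δ≢0⇒≡ δqx≢0)

∑-incidence : (e : Edge n) → ∑[ v < n ] incidence v e ≡ 2
∑-incidence (p , q) = trans (∑-distrib-+ (δ p) (δ q)) (cong₂ _+_ (∑-δ p) (∑-δ q))

handshake : (E : Multigraph n) → ∑[ v < n ] deg E v ≡ 2 * length E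
handshake E = trans (∑-weight incidence E) (trans (weight-cong ∑-incidence E) (weight-const 2 E))

joins : Fin n → Fin n → Edge n → ℕ
joins a b (p , q) = δ p a * δ q b + δ p b * δ q a

mult : Multigraph n → Fin n → Fin n → ℕ
mult E a b = weight (joins a b) E

joins-symmetric : (a b : Fin n) → Symmetric (joins a b)
joins-symmetric a b p q = trans (+-comm (δ p a * δ q b) (δ p b * δ q a))
                                (cong₂ _+_ (*-comm (δ p b) (δ q a)) (*-comm (δ p a) (δ q b)))

joins≢0⇒~ : {a b : Fin n} (e : Edge n) → joins a b e ≢ 0 → e ~ (a , b)
joins≢0⇒~ (p , q) ≢0 = ⊎-map δ*δ≢0⇒≡ δ*δ≢0⇒≡ (m+n≢0⇒m≢0⊎n≢0 _ ≢0)

~⇒joins>0 : {a b : Fin n} (e : Edge n) → e ~ (a , b) → 0 < joins a b e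
~⇒joins>0 {a = a} {b} _ (inj₁ (refl , refl)) rewrite δ-refl a | δ-refl b = s≤s z≤n
~⇒joins>0 {a = a} {b} _ (inj₂ (refl , refl)) rewrite δ-refl a | δ-refl b = m≤n+m 1 _

∑-joins : (a : Fin n) (e : Edge n) → ∑[ b < n ] joins a b e ≡ incidence a e
∑-joins {n = n} a (p , q) = begin
  ∑[ b < n ] (δ p a * δ q b + δ p b * δ q a)
    ≡⟨ ∑-distrib-+ (λ b → δ p a * δ q b) (λ b → δ p b * δ q a) ⟩
  ∑[ b < n ] (δ p a * δ q b) + ∑[ b < n ] (δ p b * δ q a)
    ≡⟨ cong₂ _+_ (*-distribˡ-sum (δ p a) (δ q)) (*-distribʳ-sum (δ q a) (δ p)) ⟨
  δ p a * ∑[ b < n ] δ q b + ∑[ b < n ] δ p b * δ q a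
    ≡⟨ cong₂ _+_ (cong (δ p a *_) (∑-δ q)) (cong (_* δ q a) (∑-δ p)) ⟩
  δ p a * 1 + 1 * δ q a
    ≡⟨ cong₂ _+_ (*-identityʳ (δ p a)) (*-identityˡ (δ q a)) ⟩
  δ p a + δ q a
    ∎
  where open ≡-Reasoning

∑-mult≡deg : (E : Multigraph n) (a : Fin n) → ∑[ b < n ] mult E a b ≡ deg E a
∑-mult≡deg E a = trans (∑-weight (joins a) E) (weight-cong (∑-joins a) E)

∈~⇒mult>0 : {e : Edge n} {a b : Fin n} → e ∈ E → e ~ (a , b) → 0 < mult E a b
∈~⇒mult>0 {a = a} {b} e∈E e~ab = ≤-trans (~⇒joins>0 _ e~ab) (weight-∈ (joins a b) e∈E)

≈⇒∈~ : {e : Edge n} {a b : Fin n} → O ≈ E → e ∈ E → e ~ (a , b) →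
       ∃[ f ] f ∈ O × f ~ (a , b)
≈⇒∈~ {O = O} {a = a} {b} O≈E e∈E e~ab
  with f , f∈O , joins≢0 ← weight≢0⇒∃ (joins a b) O
         (subst (_≢ 0) (sym (same-weight O≈E (joins a b) (joins-symmetric a b)))
                (m<n⇒n≢0 (∈~⇒mult>0 e∈E e~ab)))
  = f , f∈O , joins≢0⇒~ f joins≢0

-- Balanced orientations

record Balanced (O : Multigraph n) : Set where
  constructor balanced
  field
    outdeg≡indeg : ∀ v → outdeg O v ≡ indeg O v
open Balanced

balanced-↭ : {O′ : Multigraph n} → O ↭ O′ → Balanced O → Balanced O′
balanced-↭ O↭O′ bal = balanced λ v →
  trans (sym (weight-↭ _ O↭O′)) (trans (outdeg≡indeg bal v) (weight-↭ _ O↭O′))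

balanced-∷-loop : (x : Fin n) → Balanced O → Balanced ((x , x) ∷ O)
balanced-∷-loop x bal = balanced λ v → cong (δ x v +_) (outdeg≡indeg bal v)

balanced-subdivide : {p q : Fin n} (x : Fin n) → Balanced ((p , q) ∷ O) →
                     Balanced ((p , x) ∷ (x , q) ∷ O)
balanced-subdivide {p = p} x bal = balanced λ v →
  trans (x∙yz≈y∙xz (δ p v) (δ x v) _) (cong (δ x v +_) (outdeg≡indeg bal v))

BalancedOrientation : Multigraph n → Set
BalancedOrientation {n} E = Σ (Multigraph n) λ O → O ≈ E × Balanced O

≈-resp-BalancedOrientation : E ≈ F → BalancedOrientation E → BalancedOrientation F
≈-resp-BalancedOrientation E≈F (O , O≈E , bal) = O , ≈-trans O≈E E≈F , bal

deg-splitOff : (x y z : Fin n) (R : Multigraph n) (w : Fin n) →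
               deg ((x , y) ∷ (x , z) ∷ R) w ≡ (δ x w + δ x w) + deg ((y , z) ∷ R) w
deg-splitOff x y z R w = rearrange (δ x w) (δ y w) (δ z w) (deg R w)
  where
  rearrange : ∀ a b c r → a + b + (a + c + r) ≡ a + a + (b + c + r)
  rearrange = solve-∀

-- The edge yz, oriented p → q in O′, is replaced by the path p → x → q.
splitOff-lift : (x : Fin n) {y z : Fin n} {R : Multigraph n} →
                BalancedOrientation ((y , z) ∷ R) → BalancedOrientation ((x , y) ∷ (x , z) ∷ R)
splitOff-lift x (O′ , O′≈ , bal′)
  with (p , q) , pq∈O′ , pq~yz ← ≈⇒∈~ O′≈ (here refl) (~-refl _)
  with O₁ , O₂ , refl ← ∈-∃++ pq∈O′
  = (p , x) ∷ (x , q) ∷ O₁ ++ O₂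
  , subdivide-≈ x pq~yz (∷-cancel pq~yz (≈-trans (↭⇒≈ (↭-sym (shift _ O₁ O₂))) O′≈))
  , balanced-subdivide x (balanced-↭ (shift _ O₁ O₂) bal′)

even-deg-∷⇒deg≢0 : {x y : Fin n} (R : Multigraph n) → x ≢ y → 2 ∣ deg ((x , y) ∷ R) x →
                   deg R x ≢ 0
even-deg-∷⇒deg≢0 {x = x} {y} R x≢y 2∣deg degR≡0 =
  contradiction (∣1⇒≡1 (subst (2 ∣_) deg≡1 2∣deg)) λ ()
  where
  deg≡1 : deg ((x , y) ∷ R) x ≡ 1
  deg≡1 = cong₂ _+_ (cong₂ _+_ (δ-refl x) (δ-≢ (x≢y ∘ sym))) degR≡0

-- Induction on the number of edges: a loop is oriented arbitrarily; otherwise the odd remaining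
-- degree of x yields a second edge xz, and the pair xy, xz is split off into the single edge yz.
balancedOrientation : ∀ m (E : Multigraph n) → length E ≡ m → (∀ v → 2 ∣ deg E v) →
                      BalancedOrientation E
balancedOrientation zero    []            _       _    = [] , ≈-refl , balanced λ _ → refl
balancedOrientation (suc m) ((x , y) ∷ R) |E|≡1+m even with x ≟ y
... | yes refl
  with O , O≈R , bal ← balancedOrientation m R (suc-injective |E|≡1+m)
                          (λ v → ∣m+n∣m⇒∣n (even v) (2∣m+m (δ x v)))
  = (x , x) ∷ O , ∷-cong (~-refl _) O≈R , balanced-∷-loop x bal
... | no x≢y
  with e , e∈R , e≢0 ← weight≢0⇒∃ (incidence x) R (even-deg-∷⇒deg≢0 R x≢y (even x))
  with z , e~xz ← incidence≢0⇒~ e e≢0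
  with R₁ , R₂ , refl ← ∈-∃++ e∈R
  = ≈-resp-BalancedOrientation (≈-sym E≈split)
      (splitOff-lift x (balancedOrientation m E′ |E′|≡m even′))
  where
  E′ = (y , z) ∷ R₁ ++ R₂
  E≈split : (x , y) ∷ R₁ ++ e ∷ R₂ ≈ (x , y) ∷ (x , z) ∷ R₁ ++ R₂
  E≈split = ≈-trans (↭⇒≈ (prep _ (shift e R₁ R₂))) (∷-cong (~-refl _) (∷-cong e~xz ≈-refl))
  |E′|≡m : length E′ ≡ m
  |E′|≡m = trans (sym (↭-length (shift e R₁ R₂))) (suc-injective |E|≡1+m)
  even′ : ∀ w → 2 ∣ deg E′ w
  even′ w = ∣m+n∣m⇒∣n (subst (2 ∣_) deg≡ (even w)) (2∣m+m (δ x w))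
    where
    deg≡ : deg ((x , y) ∷ R₁ ++ e ∷ R₂) w ≡ (δ x w + δ x w) + deg E′ w
    deg≡ = trans (same-weight E≈split (incidence w) (incidence-symmetric w))
                 (deg-splitOff x y z (R₁ ++ R₂) w)

regularOrientation : {d : ℕ} (E : Multigraph n) → (∀ v → deg E v ≡ 2 * d) →
                     ∃[ O ] O ≈ E × (∀ v → outdeg O v ≡ d)
regularOrientation {d = d} E deg≡2d
  with O , O≈E , bal ← balancedOrientation _ E refl
                         (λ v → subst (2 ∣_) (sym (deg≡2d v)) (m∣m*n d))
  = O , O≈E , λ v → *-cancelˡ-≡ (outdeg O v) d 2 (begin
    2 * outdeg O v          ≡⟨ cong (outdeg O v +_) (+-identityʳ (outdeg O v)) ⟩
    outdeg O v + outdeg O v ≡⟨ cong (outdeg O v +_) (outdeg≡indeg bal v) ⟩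
    outdeg O v + indeg O v  ≡⟨ deg≡outdeg+indeg O v ⟨
    deg O v                 ≡⟨ same-weight O≈E (incidence v) (incidence-symmetric v) ⟩
    deg E v                 ≡⟨ deg≡2d v ⟩
    2 * d                   ∎)
  where open ≡-Reasoning

-- The edge list of a simple graph

pairsWhere : (Fin n → Fin n → Bool) → Multigraph n
pairsWhere {n} c = concatMap (λ x → map (x ,_) (filterᵇ (c x) (allFin n))) (allFin n)

weight-pairsWhere : (W : Edge n → ℕ) (c : Fin n → Fin n → Bool) →
                    weight W (pairsWhere c) ≡ ∑[ x < n ] ∑[ y < n ] (⟦ c x y ⟧ * W (x , y))
weight-pairsWhere {n} W c = begin
  weight W (concatMap row (allFin n))           ≡⟨ weight-concatMap W row (allFin n) ⟩
  weight (weight W ∘ row) (allFin n)            ≡⟨ weight-tabulate (weight W ∘ row) id ⟩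
  ∑[ x < n ] weight W (row x)                   ≡⟨ sum-cong-≗ weight-row ⟩
  ∑[ x < n ] ∑[ y < n ] (⟦ c x y ⟧ * W (x , y)) ∎
  where
  open ≡-Reasoning
  row : Fin n → Multigraph n
  row x = map (x ,_) (filterᵇ (c x) (allFin n))
  weight-row : ∀ x → weight W (row x) ≡ ∑[ y < n ] (⟦ c x y ⟧ * W (x , y))
  weight-row x = trans (weight-map W (x ,_) (filterᵇ (c x) (allFin n)))
    (trans (weight-filterᵇ (W ∘ (x ,_)) (c x) (allFin n))
           (weight-tabulate (λ y → ⟦ c x y ⟧ * W (x , y)) id))

deg-pairsWhere : (c : Fin n → Fin n → Bool) (v : Fin n) →
                 deg (pairsWhere c) v ≡ ∑[ y < n ] (⟦ c v y ⟧ + ⟦ c y v ⟧)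
deg-pairsWhere {n} c v = begin
  deg (pairsWhere c) v
    ≡⟨ deg≡outdeg+indeg (pairsWhere c) v ⟩
  outdeg (pairsWhere c) v + indeg (pairsWhere c) v
    ≡⟨ cong₂ _+_ outdeg≡ indeg≡ ⟩
  ∑[ y < n ] ⟦ c v y ⟧ + ∑[ y < n ] ⟦ c y v ⟧
    ≡⟨ ∑-distrib-+ (λ y → ⟦ c v y ⟧) (λ y → ⟦ c y v ⟧) ⟨
  ∑[ y < n ] (⟦ c v y ⟧ + ⟦ c y v ⟧)
    ∎
  where
  open ≡-Reasoning
  outdeg≡ : outdeg (pairsWhere c) v ≡ ∑[ y < n ] ⟦ c v y ⟧
  outdeg≡ = trans (weight-pairsWhere _ c) (∑∑-sift (λ x y → ⟦ c x y ⟧) v)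
  indeg≡ : indeg (pairsWhere c) v ≡ ∑[ x < n ] ⟦ c x v ⟧
  indeg≡ = trans (weight-pairsWhere _ c)
    (trans (∑-comm (λ x y → ⟦ c x y ⟧ * δ y v)) (∑∑-sift (λ y x → ⟦ c x y ⟧) v))

∈-pairsWhere : (c : Fin n → Fin n → Bool) {x y : Fin n} → c x y ≡ true →
               (x , y) ∈ pairsWhere c
∈-pairsWhere c {x} {y} cxy = ∈-concatMap⁺ _ (Any.map (λ { refl → row }) (∈-allFin x))
  where
  row : (x , y) ∈ map (x ,_) (filterᵇ (c x) (allFin _))
  row = ∈-map⁺ (x ,_) (∈-filter⁺ (λ y → T? (c x y)) (∈-allFin y) (subst T (sym cxy) _))

module _ (G : SimpleGraph n) where

  adj< : Fin n → Fin n → Bool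
  adj< x y = adj G x y ∧ does (x <? y)

  edgeList : Multigraph n
  edgeList = pairsWhere adj<

  degree≡∑ : (x : Fin n) → degree G x ≡ ∑[ y < n ] ⟦ adj G x y ⟧
  degree≡∑ x = trans (length-filter≡weight (T? ∘ adj G x) (allFin n))
                     (weight-tabulate (λ y → ⟦ adj G x y ⟧) id)

  adj⇒≢ : {x y : Fin n} → adj G x y ≡ true → x ≢ y
  adj⇒≢ {x} adj≡true refl = contradiction (trans (sym adj≡true) (irrefl G x)) λ ()

  ⟦adj⟧-split : (x y : Fin n) → ⟦ adj G x y ⟧ ≡ ⟦ adj< x y ⟧ + ⟦ adj< y x ⟧
  ⟦adj⟧-split x y rewrite SimpleGraph.sym G y x with adj G x y in adj≡ | <-cmp x y
  ... | false | _              = refl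
  ... | true  | tri< x<y _ y≮x rewrite dec-true (x <? y) x<y | dec-false (y <? x) y≮x = refl
  ... | true  | tri≈ _ x≡y _   = contradiction x≡y (adj⇒≢ adj≡)
  ... | true  | tri> x≮y _ y<x rewrite dec-false (x <? y) x≮y | dec-true (y <? x) y<x = refl

  deg-edgeList : (v : Fin n) → deg edgeList v ≡ degree G v
  deg-edgeList v = begin
    deg edgeList v                           ≡⟨ deg-pairsWhere adj< v ⟩
    ∑[ y < n ] (⟦ adj< v y ⟧ + ⟦ adj< y v ⟧) ≡⟨ sum-cong-≗ (⟦adj⟧-split v) ⟨
    ∑[ y < n ] ⟦ adj G v y ⟧                 ≡⟨ degree≡∑ v ⟨
    degree G v                               ∎
    where open ≡-Reasoning

  adj⇒∈edgeList : {x y : Fin n} → adj G x y ≡ true → ∃[ e ] e ∈ edgeList × e ~ (x , y)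
  adj⇒∈edgeList {x} {y} adj≡true with <-cmp x y
  ... | tri< x<y _ _ = (x , y) , ∈-pairsWhere adj< adj<≡true , ~-refl _
    where
    adj<≡true : adj< x y ≡ true
    adj<≡true rewrite adj≡true | dec-true (x <? y) x<y = refl
  ... | tri≈ _ x≡y _ = contradiction x≡y (adj⇒≢ adj≡true)
  ... | tri> _ _ y<x = (y , x) , ∈-pairsWhere adj< adj<≡true , inj₂ (refl , refl)
    where
    adj<≡true : adj< y x ≡ true
    adj<≡true rewrite SimpleGraph.sym G y x | adj≡true | dec-true (y <? x) y<x = refl

-- Builder strategies

respondTo : Fin n → (ℕ → Fin n → Fin n) → List (Fin n) → Fin n
respondTo u₀ r []         = u₀
respondTo u₀ r (v ∷ past) = r (length past) v

-- The history is never empty when Builder moves, so the default u₀ is never used.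
byRound : Fin n → (ℕ → Fin n → Fin n) → Strategy n
byRound u₀ r = respondTo u₀ r ∘ reverse

lookupOr : A → List A → ℕ → A
lookupOr a []       _       = a
lookupOr a (x ∷ xs) zero    = x
lookupOr a (x ∷ xs) (suc j) = lookupOr a xs j

lookupOr-index : {a x : A} {xs : List A} (x∈xs : x ∈ xs) → lookupOr a xs (toℕ (index x∈xs)) ≡ x
lookupOr-index (here refl)  = refl
lookupOr-index (there x∈xs) = lookupOr-index x∈xs

outNeighbours : Multigraph n → Fin n → List (Fin n)
outNeighbours O v = map proj₂ (filter (λ e → proj₁ e ≟ v) O)

length-outNeighbours : (O : Multigraph n) (v : Fin n) → length (outNeighbours O v) ≡ outdeg O v
length-outNeighbours O v = trans (length-map proj₂ (filter (λ e → proj₁ e ≟ v) O))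
                                 (length-filter≡weight (λ e → proj₁ e ≟ v) O)

∈-outNeighbours : {p q : Fin n} → (p , q) ∈ O → q ∈ outNeighbours O p
∈-outNeighbours {p = p} pq∈O = ∈-map⁺ proj₂ (∈-filter⁺ (λ e → proj₁ e ≟ p) pq∈O refl)

module _ .{{_ : NonZero n}} where

  chosen-byRound : (u₀ : Fin n) (r : ℕ → Fin n → Fin n) (π : PermSeq n) (i : ℕ) →
                   chosen (byRound u₀ r) π i ≡ r i (offered π i)
  chosen-byRound u₀ r π i = begin
    respondTo u₀ r (reverse (map f (upTo (suc i))))
      ≡⟨ cong (respondTo u₀ r ∘ reverse) history≡ ⟩
    respondTo u₀ r (reverse (map f (upTo i) ++ [ f i ]))
      ≡⟨ cong (respondTo u₀ r) (reverse-++ (map f (upTo i)) [ f i ]) ⟩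
    r (length (reverse (map f (upTo i)))) (f i)
      ≡⟨ cong (λ k → r k (f i)) length≡ ⟩
    r i (f i)
      ∎
    where
    open ≡-Reasoning
    f = offered π
    history≡ : map f (upTo (suc i)) ≡ map f (upTo i) ++ [ f i ]
    history≡ = trans (cong (map f) (sym (upTo-∷ʳ i))) (map-++ f (upTo i) [ i ])
    length≡ : length (reverse (map f (upTo i))) ≡ i
    length≡ = trans (length-reverse (map f (upTo i))) (trans (length-map f (upTo i)) (length-upTo i))

  offered-inBlock : (π : PermSeq n) (j : ℕ) (p : Fin n) →
                    ∃[ i ] i / n ≡ j × offered π i ≡ p × i < suc j * n
  offered-inBlock π j p = r + j * n , quotient , vertex , +-monoˡ-< (j * n) r<n
    where
    r = toℕ (π j ⟨$⟩ˡ p)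
    r<n : r < n
    r<n = toℕ<n (π j ⟨$⟩ˡ p)
    quotient : (r + j * n) / n ≡ j
    quotient = trans (+-distrib-/-∣ʳ r (divides-refl j))
                     (cong₂ _+_ (m<n⇒m/n≡0 r<n) (m*n/n≡m j n))
    remainder : (r + j * n) % n ≡ r
    remainder = trans ([m+kn]%n≡m%n r j n) (m<n⇒m%n≡m r<n)
    vertex : offered π (r + j * n) ≡ p
    vertex = trans (cong₂ (λ k a → π k ⟨$⟩ʳ a) quotient
                          (toℕ-injective (trans (toℕ-fromℕ< _) remainder)))
                   (inverseʳ (π j))

  follow : Fin n → Multigraph n → Strategy n
  follow u₀ O = byRound u₀ λ i v → lookupOr v (outNeighbours O v) (i / n)

  follow-plays : {d : ℕ} (u₀ : Fin n) → (∀ v → outdeg O v ≡ d) →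
                 (π : PermSeq n) {p q : Fin n} → (p , q) ∈ O →
                 ∃[ i ] i < d * n × chosen (follow u₀ O) π i ≡ q × offered π i ≡ p
  follow-plays {O = O} {d} u₀ outdeg≡d π {p} {q} pq∈O
    with q∈ ← ∈-outNeighbours pq∈O
    with i , i/n≡j , offered≡p , i<[1+j]n ← offered-inBlock π (toℕ (index q∈)) p
    = i , <-≤-trans i<[1+j]n (*-monoˡ-≤ n j<d) , chosen≡q , offered≡p
    where
    j<d : toℕ (index q∈) < d
    j<d = <-≤-trans (toℕ<n (index q∈))
                    (≤-reflexive (trans (length-outNeighbours O p) (outdeg≡d p)))
    chosen≡q : chosen (follow u₀ O) π i ≡ q
    chosen≡q = trans (chosen-byRound u₀ _ π i)
      (trans (cong₂ (λ v k → lookupOr v (outNeighbours O v) k) offered≡p i/n≡j)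
             (lookupOr-index q∈))

  played : Strategy n → PermSeq n → ℕ → Multigraph n
  played S π m = map (λ i → chosen S π i , offered π i) (upTo m)

  module _ (S : Strategy n) (π : PermSeq n) where

    HasEdge-mono : {m m′ : ℕ} {x y : Fin n} → m ≤ m′ → HasEdge S π m x y → HasEdge S π m′ x y
    HasEdge-mono m≤m′ (i , i<m , edge) = i , <-≤-trans i<m m≤m′ , edge

    HasEdge⇒mult>0 : {m : ℕ} {a b : Fin n} → HasEdge S π m a b → 0 < mult (played S π m) a b
    HasEdge⇒mult>0 (i , i<m , edge) = ∈~⇒mult>0 (∈-map⁺ _ (∈-upTo⁺ i<m)) edge

    module _ (G : SimpleGraph n) {k k′ : ℕ} where

      ContainsLab-mono : k ≤ k′ → ContainsLab G S π k → ContainsLab G S π k′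
      ContainsLab-mono k≤k′ H x y adj≡true = HasEdge-mono k≤k′ (H x y adj≡true)

      ContainsCopy-mono : k ≤ k′ → ContainsCopy G S π k → ContainsCopy G S π k′
      ContainsCopy-mono k≤k′ (σ , H) = σ , λ x y adj≡true →
        HasEdge-mono k≤k′ (H x y adj≡true)

  tauIs : (Contains : Strategy n → PermSeq n → ℕ → Set) {t : ℕ} →
          (∀ S π {k k′} → k ≤ k′ → Contains S π k → Contains S π k′) →
          (Σ (Strategy n) λ S → ∀ π → Contains S π t) →
          (∀ S π k → Contains S π k → t ≤ k) →
          TauIs Contains t
  tauIs _ mono (S , wins) lower k =
      (λ t≤k → S , λ π → mono S π t≤k (wins π))
    , (λ k<t S π contains → <⇒≱ k<t (lower S π k contains))

module _ .{{_ : NonZero n}} (G : SimpleGraph n) (d : ℕ) (regular : Regular (2 * d) G) where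

  lab-upperBound : Fin n → Σ (Strategy n) λ S → ∀ π → ContainsLab G S π (d * n)
  lab-upperBound u₀
    with O , O≈G , outdeg≡d ← regularOrientation {d = d} (edgeList G)
                                (λ v → trans (deg-edgeList G v) (regular v))
    = follow u₀ O , plays
    where
    plays : ∀ π → ContainsLab G (follow u₀ O) π (d * n)
    plays π x y adj≡true
      with e , e∈G , e~xy ← adj⇒∈edgeList G adj≡true
      with (p , q) , pq∈O , pq~xy ← ≈⇒∈~ O≈G e∈G e~xy
      with i , i<dn , chosen≡q , offered≡p ← follow-plays u₀ outdeg≡d π pq∈O
      = i , i<dn , subst₂ (λ c o → (c , o) ~ (x , y)) (sym chosen≡q) (sym offered≡p) (~-swap pq~xy)

  copy-lowerBound : ∀ S π k → ContainsCopy G S π k → d * n ≤ k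
  copy-lowerBound S π k (σ , H) = *-cancelˡ-≤ 2 (begin
    2 * (d * n)                 ≡⟨ trans (sym (*-assoc 2 d n)) (*-comm (2 * d) n) ⟩
    n * (2 * d)                 ≡⟨ ∑-const n (2 * d) ⟨
    ∑[ x < n ] (2 * d)          ≡⟨ sum-cong-≗ regular ⟨
    ∑[ x < n ] degree G x       ≤⟨ ∑-mono-≤ degree≤deg ⟩
    ∑[ x < n ] deg M (σ ⟨$⟩ʳ x) ≡⟨ ∑-permute (deg M) σ ⟨
    ∑[ v < n ] deg M v          ≡⟨ handshake M ⟩
    2 * length M                ≡⟨ cong (2 *_) (trans (length-map _ (upTo k)) (length-upTo k)) ⟩
    2 * k                       ∎)
    where
    open ≤-Reasoning
    M = played S π k
    adj≤mult : ∀ x y → ⟦ adj G x y ⟧ ≤ mult M (σ ⟨$⟩ʳ x) (σ ⟨$⟩ʳ y)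
    adj≤mult x y with adj G x y in adj≡
    ... | true  = HasEdge⇒mult>0 S π (H x y adj≡)
    ... | false = z≤n
    degree≤deg : ∀ x → degree G x ≤ deg M (σ ⟨$⟩ʳ x)
    degree≤deg x = begin
      degree G x                              ≡⟨ degree≡∑ G x ⟩
      ∑[ y < n ] ⟦ adj G x y ⟧                ≤⟨ ∑-mono-≤ (adj≤mult x) ⟩
      ∑[ y < n ] mult M (σ ⟨$⟩ʳ x) (σ ⟨$⟩ʳ y) ≡⟨ ∑-permute (mult M (σ ⟨$⟩ʳ x)) σ ⟨
      ∑[ b < n ] mult M (σ ⟨$⟩ʳ x) b          ≡⟨ ∑-mult≡deg M (σ ⟨$⟩ʳ x) ⟩
      deg M (σ ⟨$⟩ʳ x)                        ∎

corollary3p4 : (n d : ℕ) .{{_ : NonZero n}} (G : SimpleGraph n) →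
    Regular (2 * d) G →
    TauIs (ContainsCopy G) (d * n) × TauIs (ContainsLab G) (d * n)
corollary3p4 n d G regular =
  let S , wins = lab-upperBound G d regular (fromℕ< (>-nonZero⁻¹ n)) in
    tauIs (ContainsCopy G) (λ S π → ContainsCopy-mono S π G) (S , λ π → Permutation.id , wins π)
          (copy-lowerBound G d regular)
  , tauIs (ContainsLab G) (λ S π → ContainsLab-mono S π G) (S , wins)
          (λ S π k H → copy-lowerBound G d regular S π k (Permutation.id , H))
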